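{- For every positive integer $g$ there is an integer $t=t(g)$ such that for every integer $k\geq t$ there is a $k$-vertex exactly-$(2,t)$-degenerate bipartite graph of girth at least $g$.
   Context: A graph is exactly-$(2,t)$-degenerate if it can be obtained from a set of $t$ isolated vertices by repeatedly adding new vertices, each adjacent to exactly $2$ of the previously present vertices. The girth of a graph is the length of its shortest cycle (infinite if the graph has no cycle). -}

module Defs where

open import Data.Nat using (ℕ; zero; suc; _+_; _≤_; _<_; _<ᵇ_)
open import Data.Bool using (Bool; true; false; _∧_; if_then_else_; T)
open import Data.Fin using (Fin; toℕ)
open import Data.Fin.Permutation using (Permutation′; _⟨$⟩ʳ_)
open import Data.List using (List; map; allFin)
open import Data.Nat.ListAction using (sum)
open import Data.Product using (Σ; _×_; ∃)
open import Relation.Binary.PropositionalEquality using (_≡_; _≢_)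
open import Function.Definitions using (Injective)

record Graph (n : ℕ) : Set where
  field
    adj    : Fin n → Fin n → Bool
    sym    : ∀ u v → adj u v ≡ adj v u
    irrefl : ∀ v → adj v v ≡ false
open Graph public

Bipartite : ∀ {n} → Graph n → Set
Bipartite {n} G = Σ (Fin n → Bool) λ c → ∀ u v → T (adj G u v) → c u ≢ c v

record Cycle {n : ℕ} (G : Graph n) (ℓ : ℕ) : Set where
  field
    len≥3  : 3 ≤ ℓ
    vertex : Fin ℓ → Fin n
    inj    : Injective _≡_ _≡_ vertex
    step   : ∀ (i j : Fin ℓ) → suc (toℕ i) ≡ toℕ j → T (adj G (vertex i) (vertex j))
    close  : ∀ (i j : Fin ℓ) → suc (toℕ i) ≡ ℓ → toℕ j ≡ 0 → T (adj G (vertex i) (vertex j))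

GirthAtLeast : ∀ {n} → Graph n → ℕ → Set
GirthAtLeast G g = ∀ ℓ → Cycle G ℓ → g ≤ ℓ

pos : ∀ {n} → Permutation′ n → Fin n → ℕ
pos σ v = toℕ (σ ⟨$⟩ʳ v)

earlierNeighbours : ∀ {n} → Graph n → Permutation′ n → Fin n → ℕ
earlierNeighbours {n} G σ v =
  sum (map (λ u → if adj G u v ∧ (pos σ u <ᵇ pos σ v) then 1 else 0) (allFin n))

-- Exactly-(2,t)-degenerate: there is an insertion ordering σ such that the
-- first t vertices are pairwise non-adjacent (t isolated starting vertices)
-- and every later vertex has exactly 2 neighbours among earlier vertices.
-- (Every edge joins a later vertex to an earlier one, so this describes
-- precisely the graphs built by that process.)
ExactlyDegenerate : ∀ {n} → ℕ → ℕ → Graph n → Set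
ExactlyDegenerate {n} d t G = Σ (Permutation′ n) λ σ →
  (t ≤ n) ×
  (∀ u v → pos σ u < t → pos σ v < t → adj G u v ≡ false) ×
  (∀ v → t ≤ pos σ v → earlierNeighbours G σ v ≡ d)

module Submission where

-- Sanov's matrices A = (1 2 ; 0 1) and B = (1 0 ; 2 1) generate a free group: by a ping-pong
-- argument with the quadratic forms below, a nonempty reduced word in A, B and their inverses
-- moves one of four seed vectors of norm 3. A word of length ℓ ≤ g multiplies norms by at most
-- 3 ^ ℓ, so for N = 4 + 3 ^ (g + 1) it is not the identity of SL₂(ℤ/Nℤ) either. Let t be the
-- order of SL₂(ℤ/Nℤ), split the k vertices into levels of t vertices labelled by SL₂(ℤ/Nℤ), and
-- join u to the vertices of the next level labelled A u and B u. Then the first level is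
-- independent, every later vertex v has exactly the two earlier neighbours labelled A⁻¹ v and
-- B⁻¹ v, adjacent vertices lie in consecutive levels, and a cycle of length ℓ ≤ g would spell a
-- nonempty reduced word fixing an invertible label, hence the identity modulo N.

open import Data.Bool using (Bool; false; T; _∧_; _∨_; not; if_then_else_)
import Data.Bool.Properties as BoolP
open import Data.Empty using (⊥-elim)
open import Data.Fin as Fin using (Fin; toℕ; fromℕ<)
import Data.Fin.Permutation as Permutation
import Data.Fin.Properties as FinP
open import Data.Integer as ℤ using (ℤ; +_; +[1+_]; -[1+_]; 0ℤ; 1ℤ; _+_; _-_; _*_; -_; ∣_∣; +≤+)
open import Data.Integer.Divisibility.Signed using (_∣_; divides; ∣m∣n⇒∣m+n; ∣m⇒∣-m; ∣n⇒∣m*n; ∣m⇒∣m*n; ∣⇒∣ᵤ)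
open import Data.Integer.DivMod using (_%ℕ_; _/ℕ_; n%ℕd<d; a≡a%ℕn+[a/ℕn]*n)
import Data.Integer.Properties as ℤP
open import Data.Integer.Solver using (module +-*-Solver)
open import Data.List using (List; filter; length; lookup; allFin; tabulate; cartesianProduct; map)
open import Data.List.Membership.Propositional using (_∈_)
import Data.List.Membership.Propositional.Properties as ∈P
import Data.List.Properties as ListP
open import Data.List.Relation.Unary.All as All using ()
open import Data.List.Relation.Unary.AllPairs using (_∷_)
open import Data.List.Relation.Unary.Any using (index)
open import Data.List.Relation.Unary.Any.Properties using (lookup-index)
open import Data.List.Relation.Unary.Unique.Propositional using (Unique)
import Data.List.Relation.Unary.Unique.Propositional.Properties as UniqueP
open import Data.Nat as ℕ using (ℕ; zero; suc; NonZero; _≤_; _<_; _^_; z≤n; s≤s)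
open import Data.Nat.DivMod
  using (m%n<n; +-distrib-/-∣ʳ; [m+kn]%n≡m%n; m<n⇒m%n≡m; n%n≡0; m<n⇒m/n≡0; m≥n⇒m/n>0; m*n/n≡m; m≡m%n+[m/n]*n)
import Data.Nat.Divisibility as ℕD
open import Data.Nat.ListAction using (sum)
import Data.Nat.Properties as ℕP
open import Algebra.Properties.CommutativeSemigroup ℕP.+-commutativeSemigroup
  using () renaming (interchange to +-interchange)
open import Data.Nat.Tactic.RingSolver using (solve-∀)
open import Data.Product using (Σ; _×_; _,_; proj₁; proj₂)
open import Data.Product.Properties using (≡-dec)
open import Data.Product.Relation.Binary.Pointwise.NonDependent using (Pointwise; ×-setoid)
open import Data.Sum using (_⊎_; inj₁; inj₂; [_,_]′)
open import Function using (_∘_)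
open import Function.Bundles using (Equivalence)
open import Relation.Binary.Bundles using (Setoid)
open import Relation.Binary.PropositionalEquality
import Relation.Binary.Reasoning.Setoid as SetoidReasoning
open import Relation.Nullary using (¬_)
open import Relation.Nullary.Decidable
  using (Dec; yes; no; map′; ⌊_⌋; toWitness; fromWitness; dec-true; dec-false; isYes≗does; T?)

open import Defs hiding (sym)

open +-*-Solver using (solve; _:+_; _:-_; _:*_; :-_; _:=_; con)

-- Sanov's generators and ping-pong on ℤ²

Vec2 : Set
Vec2 = ℤ × ℤ

data Generator : Set where
  A A⁻¹ B B⁻¹ : Generator

inverse : Generator → Generator
inverse A   = A⁻¹
inverse A⁻¹ = A
inverse B   = B⁻¹
inverse B⁻¹ = B

inverse-involutive : ∀ s → inverse (inverse s) ≡ s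
inverse-involutive A   = refl
inverse-involutive A⁻¹ = refl
inverse-involutive B   = refl
inverse-involutive B⁻¹ = refl

act : Generator → Vec2 → Vec2
act A   (x , y) = x + (y + y) , y
act A⁻¹ (x , y) = x - (y + y) , y
act B   (x , y) = x , y + (x + x)
act B⁻¹ (x , y) = x , y - (x + x)

x+y-y≡x : ∀ x y → x + y - y ≡ x
x+y-y≡x = solve 2 (λ x y → x :+ y :- y := x) refl

x-y+y≡x : ∀ x y → x - y + y ≡ x
x-y+y≡x = solve 2 (λ x y → x :- y :+ y := x) refl

act-inverse : ∀ s v → act (inverse s) (act s v) ≡ v
act-inverse A   (x , y) = cong (_, y) (x+y-y≡x x (y + y))
act-inverse A⁻¹ (x , y) = cong (_, y) (x-y+y≡x x (y + y))
act-inverse B   (x , y) = cong (x ,_) (x+y-y≡x y (x + x))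
act-inverse B⁻¹ (x , y) = cong (x ,_) (x-y+y≡x y (x + x))

form : Generator → Vec2 → ℤ
form A   (x , y) = x * y - y * y
form A⁻¹ (x , y) = - (x * y) - y * y
form B   (x , y) = x * y - x * x
form B⁻¹ (x , y) = - (x * y) - x * x

InRegion : Generator → Vec2 → Set
InRegion s v = 0ℤ ℤ.< form s v

square-nonNeg : ∀ z → 0ℤ ℤ.≤ z * z
square-nonNeg (+ zero)  = +≤+ z≤n
square-nonNeg +[1+ n ]  = +≤+ z≤n
square-nonNeg -[1+ n ]  = +≤+ z≤n

squares-nonNeg : ∀ y z → 0ℤ ℤ.≤ y * y + z * z
squares-nonNeg y z = ℤP.+-mono-≤ (square-nonNeg y) (square-nonNeg z)

positive-growth : ∀ {e p q} → e ≡ p + q → 0ℤ ℤ.< p → 0ℤ ℤ.≤ q → 0ℤ ℤ.< e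
positive-growth refl 0<p 0≤q = ℤP.+-mono-<-≤ 0<p 0≤q

-- In each case the form of s at act s v exceeds the form of r at v by a sum of squares.
region-step : ∀ s r v → r ≢ inverse s → InRegion r v → InRegion s (act s v)
region-step A A⁻¹ v r≢ _ = ⊥-elim (r≢ refl)
region-step A⁻¹ A v r≢ _ = ⊥-elim (r≢ refl)
region-step B B⁻¹ v r≢ _ = ⊥-elim (r≢ refl)
region-step B⁻¹ B v r≢ _ = ⊥-elim (r≢ refl)
region-step A A (x , y) _ r = positive-growth (solve 2 (λ x y →
    (x :+ (y :+ y)) :* y :- y :* y
      := (x :* y :- y :* y) :+ (y :* y :+ y :* y)) refl x y)
    r (squares-nonNeg y y)
region-step A B (x , y) _ r = positive-growth (solve 2 (λ x y →
    (x :+ (y :+ y)) :* y :- y :* y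
      := (x :* y :- x :* x) :+ (x :* x :+ y :* y)) refl x y)
    r (squares-nonNeg x y)
region-step A B⁻¹ (x , y) _ r = positive-growth (solve 2 (λ x y →
    (x :+ (y :+ y)) :* y :- y :* y
      := (:- (x :* y) :- x :* x) :+ (x :+ y) :* (x :+ y)) refl x y)
    r (square-nonNeg (x + y))
region-step A⁻¹ A⁻¹ (x , y) _ r = positive-growth (solve 2 (λ x y →
    :- ((x :- (y :+ y)) :* y) :- y :* y
      := (:- (x :* y) :- y :* y) :+ (y :* y :+ y :* y)) refl x y)
    r (squares-nonNeg y y)
region-step A⁻¹ B (x , y) _ r = positive-growth (solve 2 (λ x y →
    :- ((x :- (y :+ y)) :* y) :- y :* y
      := (x :* y :- x :* x) :+ (x :- y) :* (x :- y)) refl x y)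
    r (square-nonNeg (x - y))
region-step A⁻¹ B⁻¹ (x , y) _ r = positive-growth (solve 2 (λ x y →
    :- ((x :- (y :+ y)) :* y) :- y :* y
      := (:- (x :* y) :- x :* x) :+ (x :* x :+ y :* y)) refl x y)
    r (squares-nonNeg x y)
region-step B B (x , y) _ r = positive-growth (solve 2 (λ x y →
    x :* (y :+ (x :+ x)) :- x :* x
      := (x :* y :- x :* x) :+ (x :* x :+ x :* x)) refl x y)
    r (squares-nonNeg x x)
region-step B A (x , y) _ r = positive-growth (solve 2 (λ x y →
    x :* (y :+ (x :+ x)) :- x :* x
      := (x :* y :- y :* y) :+ (x :* x :+ y :* y)) refl x y)
    r (squares-nonNeg x y)
region-step B A⁻¹ (x , y) _ r = positive-growth (solve 2 (λ x y →
    x :* (y :+ (x :+ x)) :- x :* x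
      := (:- (x :* y) :- y :* y) :+ (x :+ y) :* (x :+ y)) refl x y)
    r (square-nonNeg (x + y))
region-step B⁻¹ B⁻¹ (x , y) _ r = positive-growth (solve 2 (λ x y →
    :- (x :* (y :- (x :+ x))) :- x :* x
      := (:- (x :* y) :- x :* x) :+ (x :* x :+ x :* x)) refl x y)
    r (squares-nonNeg x x)
region-step B⁻¹ A (x , y) _ r = positive-growth (solve 2 (λ x y →
    :- (x :* (y :- (x :+ x))) :- x :* x
      := (x :* y :- y :* y) :+ (x :- y) :* (x :- y)) refl x y)
    r (square-nonNeg (x - y))
region-step B⁻¹ A⁻¹ (x , y) _ r = positive-growth (solve 2 (λ x y →
    :- (x :* (y :- (x :+ x))) :- x :* x
      := (:- (x :* y) :- y :* y) :+ (x :* x :+ y :* y)) refl x y)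
    r (squares-nonNeg x y)

seed : Generator → Vec2
seed A   = + 2 , + 1
seed A⁻¹ = + 2 , - + 1
seed B   = + 1 , + 2
seed B⁻¹ = + 1 , - + 2

seed-inRegion : ∀ r → InRegion r (seed r)
seed-inRegion A   = ℤ.+<+ (s≤s z≤n)
seed-inRegion A⁻¹ = ℤ.+<+ (s≤s z≤n)
seed-inRegion B   = ℤ.+<+ (s≤s z≤n)
seed-inRegion B⁻¹ = ℤ.+<+ (s≤s z≤n)

seed-region : ∀ {r s} → InRegion s (seed r) → s ≡ r
seed-region {A}   {A}   _ = refl
seed-region {A⁻¹} {A⁻¹} _ = refl
seed-region {B}   {B}   _ = refl
seed-region {B⁻¹} {B⁻¹} _ = refl
seed-region {A}   {A⁻¹} ()
seed-region {A}   {B}   ()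
seed-region {A}   {B⁻¹} ()
seed-region {A⁻¹} {A}   ()
seed-region {A⁻¹} {B}   ()
seed-region {A⁻¹} {B⁻¹} ()
seed-region {B}   {A}   ()
seed-region {B}   {A⁻¹} ()
seed-region {B}   {B⁻¹} ()
seed-region {B⁻¹} {A}   ()
seed-region {B⁻¹} {A⁻¹} ()
seed-region {B⁻¹} {B}   ()

inverse-≢ : ∀ s → s ≢ inverse s
inverse-≢ A   ()
inverse-≢ A⁻¹ ()
inverse-≢ B   ()
inverse-≢ B⁻¹ ()

perpendicular : Generator → Generator
perpendicular A   = B
perpendicular A⁻¹ = B
perpendicular B   = A
perpendicular B⁻¹ = A

perpendicular-≢ : ∀ s → perpendicular s ≢ s
perpendicular-≢ A   ()
perpendicular-≢ A⁻¹ ()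
perpendicular-≢ B   ()
perpendicular-≢ B⁻¹ ()

perpendicular-≢-inverse : ∀ s → perpendicular s ≢ inverse s
perpendicular-≢-inverse A   ()
perpendicular-≢-inverse A⁻¹ ()
perpendicular-≢-inverse B   ()
perpendicular-≢-inverse B⁻¹ ()

act⋆ : (ℕ → Generator) → ℕ → Vec2 → Vec2
act⋆ w zero    v = v
act⋆ w (suc m) v = act (w m) (act⋆ w m v)

Reduced : (ℕ → Generator) → ℕ → Set
Reduced w m = ∀ i → suc i < m → w i ≢ inverse (w (suc i))

ping-pong : ∀ w m {r v} → Reduced w (suc m) → r ≢ inverse (w 0) → InRegion r v →
           InRegion (w m) (act⋆ w (suc m) v)
ping-pong w zero    reduced r≢ v∈r = region-step (w 0) _ _ r≢ v∈r
ping-pong w (suc m) reduced r≢ v∈r =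
  region-step (w (suc m)) (w m) _ (reduced m ℕP.≤-refl)
    (ping-pong w m (λ i i<m → reduced i (ℕP.m≤n⇒m≤1+n i<m)) r≢ v∈r)

no-reduced-word-fixes-seeds : ∀ w m → Reduced w (suc m) → ¬ (∀ r → act⋆ w (suc m) (seed r) ≡ seed r)
no-reduced-word-fixes-seeds w m reduced fixes =
  perpendicular-≢ (w 0) (trans (sym (lands-in (perpendicular (w 0)) (perpendicular-≢-inverse (w 0))))
                               (lands-in (w 0) (inverse-≢ (w 0))))
  where
  lands-in : ∀ r → r ≢ inverse (w 0) → w m ≡ r
  lands-in r r≢ = seed-region (subst (InRegion (w m)) (fixes r) (ping-pong w m reduced r≢ (seed-inRegion r)))

norm : Vec2 → ℕ
norm (x , y) = ∣ x ∣ ℕ.+ ∣ y ∣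

∣x+[y+y]∣≤ : ∀ x y → ∣ x + (y + y) ∣ ≤ ∣ x ∣ ℕ.+ (∣ y ∣ ℕ.+ ∣ y ∣)
∣x+[y+y]∣≤ x y =
  ℕP.≤-trans (ℤP.∣i+j∣≤∣i∣+∣j∣ x (y + y)) (ℕP.+-monoʳ-≤ ∣ x ∣ (ℤP.∣i+j∣≤∣i∣+∣j∣ y y))

∣x-[y+y]∣≤ : ∀ x y → ∣ x - (y + y) ∣ ≤ ∣ x ∣ ℕ.+ (∣ y ∣ ℕ.+ ∣ y ∣)
∣x-[y+y]∣≤ x y =
  ℕP.≤-trans (ℤP.∣i-j∣≤∣i∣+∣j∣ x (y + y)) (ℕP.+-monoʳ-≤ ∣ x ∣ (ℤP.∣i+j∣≤∣i∣+∣j∣ y y))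

p+[q+q]+q≤3[p+q] : ∀ p q → p ℕ.+ (q ℕ.+ q) ℕ.+ q ≤ 3 ℕ.* (p ℕ.+ q)
p+[q+q]+q≤3[p+q] p q = ℕP.≤-trans (ℕP.m≤m+n _ (p ℕ.+ p)) (ℕP.≤-reflexive (identity p q))
  where
  identity : ∀ p q → p ℕ.+ (q ℕ.+ q) ℕ.+ q ℕ.+ (p ℕ.+ p) ≡ 3 ℕ.* (p ℕ.+ q)
  identity = solve-∀

p+[q+[p+p]]≤3[p+q] : ∀ p q → p ℕ.+ (q ℕ.+ (p ℕ.+ p)) ≤ 3 ℕ.* (p ℕ.+ q)
p+[q+[p+p]]≤3[p+q] p q = ℕP.≤-trans (ℕP.m≤m+n _ (q ℕ.+ q)) (ℕP.≤-reflexive (identity p q))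
  where
  identity : ∀ p q → p ℕ.+ (q ℕ.+ (p ℕ.+ p)) ℕ.+ (q ℕ.+ q) ≡ 3 ℕ.* (p ℕ.+ q)
  identity = solve-∀

norm-act : ∀ s v → norm (act s v) ≤ 3 ℕ.* norm v
norm-act A   (x , y) = ℕP.≤-trans (ℕP.+-monoˡ-≤ ∣ y ∣ (∣x+[y+y]∣≤ x y)) (p+[q+q]+q≤3[p+q] ∣ x ∣ ∣ y ∣)
norm-act A⁻¹ (x , y) = ℕP.≤-trans (ℕP.+-monoˡ-≤ ∣ y ∣ (∣x-[y+y]∣≤ x y)) (p+[q+q]+q≤3[p+q] ∣ x ∣ ∣ y ∣)
norm-act B   (x , y) = ℕP.≤-trans (ℕP.+-monoʳ-≤ ∣ x ∣ (∣x+[y+y]∣≤ y x)) (p+[q+[p+p]]≤3[p+q] ∣ x ∣ ∣ y ∣)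
norm-act B⁻¹ (x , y) = ℕP.≤-trans (ℕP.+-monoʳ-≤ ∣ x ∣ (∣x-[y+y]∣≤ y x)) (p+[q+[p+p]]≤3[p+q] ∣ x ∣ ∣ y ∣)

norm-act⋆ : ∀ w m v → norm (act⋆ w m v) ≤ 3 ^ m ℕ.* norm v
norm-act⋆ w zero    v = ℕP.≤-reflexive (sym (ℕP.+-identityʳ (norm v)))
norm-act⋆ w (suc m) v = begin
  norm (act (w m) (act⋆ w m v)) ≤⟨ norm-act (w m) (act⋆ w m v) ⟩
  3 ℕ.* norm (act⋆ w m v)        ≤⟨ ℕP.*-monoʳ-≤ 3 (norm-act⋆ w m v) ⟩
  3 ℕ.* (3 ^ m ℕ.* norm v)       ≡⟨ ℕP.*-assoc 3 (3 ^ m) (norm v) ⟨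
  3 ^ suc m ℕ.* norm v           ∎
  where open ℕP.≤-Reasoning

-- Linear algebra on ℤ²

infixl 6 _+ᵥ_
infixr 7 _·_

_+ᵥ_ : Vec2 → Vec2 → Vec2
(x , y) +ᵥ (x′ , y′) = x + x′ , y + y′

_·_ : ℤ → Vec2 → Vec2
α · (x , y) = α * x , α * y

det : Vec2 → Vec2 → ℤ
det (x₁ , y₁) (x₂ , y₂) = x₁ * y₂ - x₂ * y₁

·-identityˡ : ∀ v → 1ℤ · v ≡ v
·-identityˡ (x , y) = cong₂ _,_ (ℤP.*-identityˡ x) (ℤP.*-identityˡ y)

cramer : ∀ c₁ c₂ v → det c₁ c₂ · v ≡ det v c₂ · c₁ +ᵥ det c₁ v · c₂
cramer (x₁ , y₁) (x₂ , y₂) (x , y) = cong₂ _,_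
  (solve 6 (λ x₁ y₁ x₂ y₂ x y →
     (x₁ :* y₂ :- x₂ :* y₁) :* x := (x :* y₂ :- x₂ :* y) :* x₁ :+ (x₁ :* y :- x :* y₁) :* x₂) refl x₁ y₁ x₂ y₂ x y)
  (solve 6 (λ x₁ y₁ x₂ y₂ x y →
     (x₁ :* y₂ :- x₂ :* y₁) :* y := (x :* y₂ :- x₂ :* y) :* y₁ :+ (x₁ :* y :- x :* y₁) :* y₂) refl x₁ y₁ x₂ y₂ x y)

act-+ᵥ : ∀ s u w → act s (u +ᵥ w) ≡ act s u +ᵥ act s w
act-+ᵥ A   (x , y) (x′ , y′) = cong (_, y + y′) (solve 4 (λ x y x′ y′ →
  (x :+ x′) :+ ((y :+ y′) :+ (y :+ y′)) := (x :+ (y :+ y)) :+ (x′ :+ (y′ :+ y′))) refl x y x′ y′)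
act-+ᵥ A⁻¹ (x , y) (x′ , y′) = cong (_, y + y′) (solve 4 (λ x y x′ y′ →
  (x :+ x′) :- ((y :+ y′) :+ (y :+ y′)) := (x :- (y :+ y)) :+ (x′ :- (y′ :+ y′))) refl x y x′ y′)
act-+ᵥ B   (x , y) (x′ , y′) = cong (x + x′ ,_) (solve 4 (λ x y x′ y′ →
  (y :+ y′) :+ ((x :+ x′) :+ (x :+ x′)) := (y :+ (x :+ x)) :+ (y′ :+ (x′ :+ x′))) refl x y x′ y′)
act-+ᵥ B⁻¹ (x , y) (x′ , y′) = cong (x + x′ ,_) (solve 4 (λ x y x′ y′ →
  (y :+ y′) :- ((x :+ x′) :+ (x :+ x′)) := (y :- (x :+ x)) :+ (y′ :- (x′ :+ x′))) refl x y x′ y′)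

act-· : ∀ s α u → act s (α · u) ≡ α · act s u
act-· A   α (x , y) = cong (_, α * y) (solve 3 (λ α x y →
  α :* x :+ (α :* y :+ α :* y) := α :* (x :+ (y :+ y))) refl α x y)
act-· A⁻¹ α (x , y) = cong (_, α * y) (solve 3 (λ α x y →
  α :* x :- (α :* y :+ α :* y) := α :* (x :- (y :+ y))) refl α x y)
act-· B   α (x , y) = cong (α * x ,_) (solve 3 (λ α x y →
  α :* y :+ (α :* x :+ α :* x) := α :* (y :+ (x :+ x))) refl α x y)
act-· B⁻¹ α (x , y) = cong (α * x ,_) (solve 3 (λ α x y →
  α :* y :- (α :* x :+ α :* x) := α :* (y :- (x :+ x))) refl α x y)

act⋆-+ᵥ : ∀ w m u v → act⋆ w m (u +ᵥ v) ≡ act⋆ w m u +ᵥ act⋆ w m v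
act⋆-+ᵥ w zero    u v = refl
act⋆-+ᵥ w (suc m) u v = trans (cong (act (w m)) (act⋆-+ᵥ w m u v)) (act-+ᵥ (w m) _ _)

act⋆-· : ∀ w m α u → act⋆ w m (α · u) ≡ α · act⋆ w m u
act⋆-· w zero    α u = refl
act⋆-· w (suc m) α u = trans (cong (act (w m)) (act⋆-· w m α u)) (act-· (w m) α _)

det-act : ∀ s c₁ c₂ → det (act s c₁) (act s c₂) ≡ det c₁ c₂
det-act A (x₁ , y₁) (x₂ , y₂) = solve 4 (λ x₁ y₁ x₂ y₂ →
  (x₁ :+ (y₁ :+ y₁)) :* y₂ :- (x₂ :+ (y₂ :+ y₂)) :* y₁ := x₁ :* y₂ :- x₂ :* y₁) refl x₁ y₁ x₂ y₂
det-act A⁻¹ (x₁ , y₁) (x₂ , y₂) = solve 4 (λ x₁ y₁ x₂ y₂ →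
  (x₁ :- (y₁ :+ y₁)) :* y₂ :- (x₂ :- (y₂ :+ y₂)) :* y₁ := x₁ :* y₂ :- x₂ :* y₁) refl x₁ y₁ x₂ y₂
det-act B (x₁ , y₁) (x₂ , y₂) = solve 4 (λ x₁ y₁ x₂ y₂ →
  x₁ :* (y₂ :+ (x₂ :+ x₂)) :- x₂ :* (y₁ :+ (x₁ :+ x₁)) := x₁ :* y₂ :- x₂ :* y₁) refl x₁ y₁ x₂ y₂
det-act B⁻¹ (x₁ , y₁) (x₂ , y₂) = solve 4 (λ x₁ y₁ x₂ y₂ →
  x₁ :* (y₂ :- (x₂ :+ x₂)) :- x₂ :* (y₁ :- (x₁ :+ x₁)) := x₁ :* y₂ :- x₂ :* y₁) refl x₁ y₁ x₂ y₂

-- Congruences modulo N and SL₂(ℤ/Nℤ)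

Mat2 : Set
Mat2 = Vec2 × Vec2

actₘ : Generator → Mat2 → Mat2
actₘ s (c₁ , c₂) = act s c₁ , act s c₂

detₘ : Mat2 → ℤ
detₘ (c₁ , c₂) = det c₁ c₂

actₘ-inverse : ∀ s M → actₘ (inverse s) (actₘ s M) ≡ M
actₘ-inverse s (c₁ , c₂) = cong₂ _,_ (act-inverse s c₁) (act-inverse s c₂)

actₘ⋆ : (ℕ → Generator) → ℕ → Mat2 → Mat2
actₘ⋆ w m (c₁ , c₂) = act⋆ w m c₁ , act⋆ w m c₂

module Modulo (N : ℕ) .{{_ : NonZero N}} where

  infix 4 _≈_ _≈ᵥ_ _≈ₘ_

  -- A record rather than a definition, so that unification never looks inside a congruence.
  record _≈_ (x y : ℤ) : Set where
    constructor ≈-intro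
    field divides-difference : + N ∣ x - y

  ≈-reflexive : ∀ {x y} → x ≡ y → x ≈ y
  ≈-reflexive {x} refl = ≈-intro (divides 0ℤ (ℤP.+-inverseʳ x))

  ≈-refl : ∀ {x} → x ≈ x
  ≈-refl = ≈-reflexive refl

  ≈-sym : ∀ {x y} → x ≈ y → y ≈ x
  ≈-sym {x} {y} (≈-intro N∣x-y) = ≈-intro (subst (+ N ∣_) (identity x y) (∣m⇒∣-m N∣x-y))
    where
    identity : ∀ x y → - (x - y) ≡ y - x
    identity = solve 2 (λ x y → :- (x :- y) := y :- x) refl

  ≈-trans : ∀ {x y z} → x ≈ y → y ≈ z → x ≈ z
  ≈-trans {x} {y} {z} (≈-intro N∣x-y) (≈-intro N∣y-z) =
    ≈-intro (subst (+ N ∣_) (ℤP.+-minus-telescope x y z) (∣m∣n⇒∣m+n N∣x-y N∣y-z))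

  ≈-setoid : Setoid _ _
  ≈-setoid = record
    { Carrier = ℤ ; _≈_ = _≈_
    ; isEquivalence = record { refl = ≈-refl ; sym = ≈-sym ; trans = ≈-trans } }

  +-cong : ∀ {x x′ y y′} → x ≈ x′ → y ≈ y′ → x + y ≈ x′ + y′
  +-cong {x} {x′} {y} {y′} (≈-intro N∣x-x′) (≈-intro N∣y-y′) =
    ≈-intro (subst (+ N ∣_) (identity x x′ y y′) (∣m∣n⇒∣m+n N∣x-x′ N∣y-y′))
    where
    identity : ∀ x x′ y y′ → (x - x′) + (y - y′) ≡ (x + y) - (x′ + y′)
    identity = solve 4 (λ x x′ y y′ → (x :- x′) :+ (y :- y′) := (x :+ y) :- (x′ :+ y′)) refl

  neg-cong : ∀ {x x′} → x ≈ x′ → - x ≈ - x′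
  neg-cong {x} {x′} (≈-intro N∣x-x′) = ≈-intro (subst (+ N ∣_) (identity x x′) (∣m⇒∣-m N∣x-x′))
    where
    identity : ∀ x x′ → - (x - x′) ≡ - x - - x′
    identity = solve 2 (λ x x′ → :- (x :- x′) := :- x :- :- x′) refl

  *-cong : ∀ {x x′ y y′} → x ≈ x′ → y ≈ y′ → x * y ≈ x′ * y′
  *-cong {x} {x′} {y} {y′} (≈-intro N∣x-x′) (≈-intro N∣y-y′) =
    ≈-intro (subst (+ N ∣_) (identity x x′ y y′) (∣m∣n⇒∣m+n (∣m⇒∣m*n y N∣x-x′) (∣n⇒∣m*n x′ N∣y-y′)))
    where
    identity : ∀ x x′ y y′ → (x - x′) * y + x′ * (y - y′) ≡ x * y - x′ * y′
    identity = solve 4 (λ x x′ y y′ → (x :- x′) :* y :+ x′ :* (y :- y′) := x :* y :- x′ :* y′) refl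

  ≈-cancelˡ : ∀ {y d} → y ≈ y - d → d ≈ 0ℤ
  ≈-cancelˡ {y} {d} (≈-intro N∣y-[y-d]) = ≈-intro (subst (+ N ∣_) (identity y d) N∣y-[y-d])
    where
    identity : ∀ y d → y - (y - d) ≡ d - 0ℤ
    identity = solve 2 (λ y d → y :- (y :- d) := d :- con 0ℤ) refl

  ≈-small⇒≡ : ∀ {x y} → x ≈ y → ∣ x - y ∣ < N → x ≡ y
  ≈-small⇒≡ {x} {y} (≈-intro N∣x-y) small =
    ℤP.i-j≡0⇒i≡j x y (ℤP.∣i∣≡0⇒i≡0 (multiple-small⇒0 (∣⇒∣ᵤ N∣x-y) small))
    where
    multiple-small⇒0 : ∀ {d} → N ℕD.∣ d → d < N → d ≡ 0
    multiple-small⇒0 {zero}  _   _   = refl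
    multiple-small⇒0 {suc d} N∣d d<N = ⊥-elim (ℕD.>⇒∤ d<N N∣d)

  lift : Fin N → ℤ
  lift e = + toℕ e

  reduce : ℤ → Fin N
  reduce z = fromℕ< (n%ℕd<d z N)

  lift-reduce : ∀ z → lift (reduce z) ≈ z
  lift-reduce z = ≈-intro (divides (- (z /ℕ N)) (begin
    lift (reduce z) - z                           ≡⟨ cong (λ r → + r - z) (FinP.toℕ-fromℕ< (n%ℕd<d z N)) ⟩
    + (z %ℕ N) - z                                ≡⟨ cong (λ w → + (z %ℕ N) - w) (a≡a%ℕn+[a/ℕn]*n z N) ⟩
    + (z %ℕ N) - (+ (z %ℕ N) + (z /ℕ N) * + N)    ≡⟨ identity (+ (z %ℕ N)) (z /ℕ N) (+ N) ⟩
    - (z /ℕ N) * + N                              ∎))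
    where
    open ≡-Reasoning
    identity : ∀ r q n → r - (r + q * n) ≡ - q * n
    identity = solve 3 (λ r q n → r :- (r :+ q :* n) := :- q :* n) refl

  lift-injective : ∀ {e e′} → lift e ≈ lift e′ → e ≡ e′
  lift-injective {e} {e′} e≈e′ = FinP.toℕ-injective (ℤP.+-injective (≈-small⇒≡ e≈e′ small))
    where
    small : ∣ lift e - lift e′ ∣ < N
    small = begin-strict
      ∣ + toℕ e - + toℕ e′ ∣     ≡⟨ cong ∣_∣ (ℤP.[+m]-[+n]≡m⊖n (toℕ e) (toℕ e′)) ⟩
      ∣ toℕ e ℤ.⊖ toℕ e′ ∣       ≤⟨ ℤP.∣m⊝n∣≤m⊔n (toℕ e) (toℕ e′) ⟩
      toℕ e ℕ.⊔ toℕ e′           <⟨ ℕP.⊔-lub (FinP.toℕ<n e) (FinP.toℕ<n e′) ⟩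
      N                          ∎
      where open ℕP.≤-Reasoning

  reduce-cong : ∀ {x y} → x ≈ y → reduce x ≡ reduce y
  reduce-cong {x} {y} x≈y = lift-injective (≈-trans (lift-reduce x) (≈-trans x≈y (≈-sym (lift-reduce y))))

  reduce-≡⇒≈ : ∀ {x y} → reduce x ≡ reduce y → x ≈ y
  reduce-≡⇒≈ {x} {y} eq =
    ≈-trans (≈-sym (lift-reduce x)) (≈-trans (≈-reflexive (cong lift eq)) (lift-reduce y))

  _≈ᵥ_ : Vec2 → Vec2 → Set
  _≈ᵥ_ = Pointwise _≈_ _≈_

  ≈ᵥ-setoid : Setoid _ _
  ≈ᵥ-setoid = ×-setoid ≈-setoid ≈-setoid

  _≈ₘ_ : Mat2 → Mat2 → Set
  _≈ₘ_ = Pointwise _≈ᵥ_ _≈ᵥ_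

  ≈ₘ-setoid : Setoid _ _
  ≈ₘ-setoid = ×-setoid ≈ᵥ-setoid ≈ᵥ-setoid

  open Setoid ≈ᵥ-setoid using () renaming (reflexive to ≈ᵥ-reflexive)
  open Setoid ≈ₘ-setoid public using () renaming (reflexive to ≈ₘ-reflexive; sym to ≈ₘ-sym; trans to ≈ₘ-trans)

  +ᵥ-cong : ∀ {u u′ w w′} → u ≈ᵥ u′ → w ≈ᵥ w′ → u +ᵥ w ≈ᵥ u′ +ᵥ w′
  +ᵥ-cong (x≈ , y≈) (x′≈ , y′≈) = +-cong x≈ x′≈ , +-cong y≈ y′≈

  ·-cong : ∀ {α α′ u u′} → α ≈ α′ → u ≈ᵥ u′ → α · u ≈ᵥ α′ · u′
  ·-cong α≈ (x≈ , y≈) = *-cong α≈ x≈ , *-cong α≈ y≈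

  act-cong : ∀ s {u u′} → u ≈ᵥ u′ → act s u ≈ᵥ act s u′
  act-cong A   (x≈ , y≈) = +-cong x≈ (+-cong y≈ y≈) , y≈
  act-cong A⁻¹ (x≈ , y≈) = +-cong x≈ (neg-cong (+-cong y≈ y≈)) , y≈
  act-cong B   (x≈ , y≈) = x≈ , +-cong y≈ (+-cong x≈ x≈)
  act-cong B⁻¹ (x≈ , y≈) = x≈ , +-cong y≈ (neg-cong (+-cong x≈ x≈))

  det-cong : ∀ {c₁ c₁′ c₂ c₂′} → c₁ ≈ᵥ c₁′ → c₂ ≈ᵥ c₂′ → det c₁ c₂ ≈ det c₁′ c₂′
  det-cong (x₁≈ , y₁≈) (x₂≈ , y₂≈) = +-cong (*-cong x₁≈ y₂≈) (neg-cong (*-cong x₂≈ y₁≈))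

  actₘ-cong : ∀ s {M M′} → M ≈ₘ M′ → actₘ s M ≈ₘ actₘ s M′
  actₘ-cong s (c₁≈ , c₂≈) = act-cong s c₁≈ , act-cong s c₂≈

  detₘ-cong : ∀ {M M′} → M ≈ₘ M′ → detₘ M ≈ detₘ M′
  detₘ-cong (c₁≈ , c₂≈) = det-cong c₁≈ c₂≈

  -- Cramer's rule writes (det c₁ c₂) · v as a combination of c₁ and c₂, and F is linear.
  fixes-unimodular-basis⇒fixes-all : (F : Vec2 → Vec2) →
    (∀ u w → F (u +ᵥ w) ≡ F u +ᵥ F w) → (∀ α u → F (α · u) ≡ α · F u) →
    ∀ {c₁ c₂} → F c₁ ≈ᵥ c₁ → F c₂ ≈ᵥ c₂ → det c₁ c₂ ≈ 1ℤ → ∀ v → F v ≈ᵥ v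
  fixes-unimodular-basis⇒fixes-all F additive homogeneous {c₁} {c₂} Fc₁≈c₁ Fc₂≈c₂ d≈1 v = begin
    F v                                 ≡⟨ ·-identityˡ (F v) ⟨
    1ℤ · F v                            ≈⟨ ·-cong (≈-sym d≈1) (≈ᵥ-reflexive refl) ⟩
    d · F v                             ≡⟨ homogeneous d v ⟨
    F (d · v)                           ≡⟨ cong F (cramer c₁ c₂ v) ⟩
    F (α · c₁ +ᵥ β · c₂)                ≡⟨ additive (α · c₁) (β · c₂) ⟩
    F (α · c₁) +ᵥ F (β · c₂)            ≡⟨ cong₂ _+ᵥ_ (homogeneous α c₁) (homogeneous β c₂) ⟩
    α · F c₁ +ᵥ β · F c₂                ≈⟨ +ᵥ-cong (·-cong (≈-refl {α}) Fc₁≈c₁) (·-cong (≈-refl {β}) Fc₂≈c₂) ⟩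
    α · c₁ +ᵥ β · c₂                    ≡⟨ cramer c₁ c₂ v ⟨
    d · v                               ≈⟨ ·-cong d≈1 (≈ᵥ-reflexive refl) ⟩
    1ℤ · v                              ≡⟨ ·-identityˡ v ⟩
    v                                   ∎
    where
    open SetoidReasoning ≈ᵥ-setoid
    d α β : ℤ
    d = det c₁ c₂
    α = det v c₂
    β = det c₁ v

  Vecₙ : Set
  Vecₙ = Fin N × Fin N

  Matₙ : Set
  Matₙ = Vecₙ × Vecₙ

  liftᵥ : Vecₙ → Vec2
  liftᵥ (x , y) = lift x , lift y

  reduceᵥ : Vec2 → Vecₙ
  reduceᵥ (x , y) = reduce x , reduce y

  liftₘ : Matₙ → Mat2
  liftₘ (c₁ , c₂) = liftᵥ c₁ , liftᵥ c₂

  reduceₘ : Mat2 → Matₙ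
  reduceₘ (c₁ , c₂) = reduceᵥ c₁ , reduceᵥ c₂

  liftₘ-reduceₘ : ∀ M → liftₘ (reduceₘ M) ≈ₘ M
  liftₘ-reduceₘ ((x₁ , y₁) , (x₂ , y₂)) = (lift-reduce x₁ , lift-reduce y₁) , (lift-reduce x₂ , lift-reduce y₂)

  liftₘ-injective : ∀ {X Y} → liftₘ X ≈ₘ liftₘ Y → X ≡ Y
  liftₘ-injective ((x₁≈ , y₁≈) , (x₂≈ , y₂≈)) =
    cong₂ _,_ (cong₂ _,_ (lift-injective x₁≈) (lift-injective y₁≈))
              (cong₂ _,_ (lift-injective x₂≈) (lift-injective y₂≈))

  mulₙ : Generator → Matₙ → Matₙ
  mulₙ s X = reduceₘ (actₘ s (liftₘ X))

  liftₘ-mulₙ : ∀ s X → liftₘ (mulₙ s X) ≈ₘ actₘ s (liftₘ X)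
  liftₘ-mulₙ s X = liftₘ-reduceₘ (actₘ s (liftₘ X))

  mulₙ-inverse : ∀ s X → mulₙ (inverse s) (mulₙ s X) ≡ X
  mulₙ-inverse s X = liftₘ-injective (begin
    liftₘ (mulₙ (inverse s) (mulₙ s X))     ≈⟨ liftₘ-mulₙ (inverse s) (mulₙ s X) ⟩
    actₘ (inverse s) (liftₘ (mulₙ s X))     ≈⟨ actₘ-cong (inverse s) (liftₘ-mulₙ s X) ⟩
    actₘ (inverse s) (actₘ s (liftₘ X))     ≡⟨ actₘ-inverse s (liftₘ X) ⟩
    liftₘ X                                 ∎)
    where open SetoidReasoning ≈ₘ-setoid

  mulₙ-inverseʳ : ∀ s X → mulₙ s (mulₙ (inverse s) X) ≡ X
  mulₙ-inverseʳ s X =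
    subst (λ r → mulₙ r (mulₙ (inverse s) X) ≡ X) (inverse-involutive s) (mulₙ-inverse (inverse s) X)

  _≟ₘ_ : (X Y : Matₙ) → Dec (X ≡ Y)
  _≟ₘ_ = ≡-dec (≡-dec Fin._≟_ Fin._≟_) (≡-dec Fin._≟_ Fin._≟_)

  ≈ᵥ-small⇒≡ : ∀ {u w} → u ≈ᵥ w → norm u ℕ.+ norm w < N → u ≡ w
  ≈ᵥ-small⇒≡ {x , y} {x′ , y′} (x≈ , y≈) small = cong₂ _,_
    (≈-small⇒≡ x≈ (difference-small x x′ (ℕP.m≤m+n ∣ x ∣ ∣ y ∣) (ℕP.m≤m+n ∣ x′ ∣ ∣ y′ ∣)))
    (≈-small⇒≡ y≈ (difference-small y y′ (ℕP.m≤n+m ∣ y ∣ ∣ x ∣) (ℕP.m≤n+m ∣ y′ ∣ ∣ x′ ∣)))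
    where
    difference-small : ∀ a a′ → ∣ a ∣ ≤ norm (x , y) → ∣ a′ ∣ ≤ norm (x′ , y′) → ∣ a - a′ ∣ < N
    difference-small a a′ a≤ a′≤ = ℕP.≤-<-trans (ℤP.∣i-j∣≤∣i∣+∣j∣ a a′) (ℕP.≤-<-trans (ℕP.+-mono-≤ a≤ a′≤) small)

  Unimodular : Matₙ → Set
  Unimodular X = detₘ (liftₘ X) ≈ 1ℤ

  unimodular? : ∀ X → Dec (Unimodular X)
  unimodular? X = map′ reduce-≡⇒≈ reduce-cong (reduce (detₘ (liftₘ X)) Fin.≟ reduce 1ℤ)

  mulₙ-unimodular : ∀ s {X} → Unimodular X → Unimodular (mulₙ s X)
  mulₙ-unimodular s {X} det≈1 = begin
    detₘ (liftₘ (mulₙ s X))     ≈⟨ detₘ-cong (liftₘ-mulₙ s X) ⟩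
    detₘ (actₘ s (liftₘ X))     ≡⟨ det-act s _ _ ⟩
    detₘ (liftₘ X)              ≈⟨ det≈1 ⟩
    1ℤ                          ∎
    where open SetoidReasoning ≈-setoid

  -- A⁻¹X ≡ B⁻¹X forces 2x ≡ 0 for both entries x of the first row of X, hence 2 ≡ 2 det X ≡ 0.
  mulₙ-A⁻¹≢mulₙ-B⁻¹ : 2 < N → ∀ {X} → Unimodular X → mulₙ A⁻¹ X ≢ mulₙ B⁻¹ X
  mulₙ-A⁻¹≢mulₙ-B⁻¹ 2<N {(x₁ , y₁) , (x₂ , y₂)} det≈1 eq = two≢0 (≈-small⇒≡ 2≈0 2<N)
    where
    open SetoidReasoning ≈-setoid
    two≢0 : + 2 ≢ 0ℤ
    two≢0 ()
    A⁻¹X≈B⁻¹X : actₘ A⁻¹ (liftₘ ((x₁ , y₁) , (x₂ , y₂))) ≈ₘ actₘ B⁻¹ (liftₘ ((x₁ , y₁) , (x₂ , y₂)))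
    A⁻¹X≈B⁻¹X = ≈ₘ-trans (≈ₘ-sym (liftₘ-mulₙ A⁻¹ _))
                         (≈ₘ-trans (≈ₘ-reflexive (cong liftₘ eq)) (liftₘ-mulₙ B⁻¹ _))
    2x₁≈0 : lift x₁ + lift x₁ ≈ 0ℤ
    2x₁≈0 = ≈-cancelˡ (proj₂ (proj₁ A⁻¹X≈B⁻¹X))
    2x₂≈0 : lift x₂ + lift x₂ ≈ 0ℤ
    2x₂≈0 = ≈-cancelˡ (proj₂ (proj₂ A⁻¹X≈B⁻¹X))
    2≈0 : + 2 ≈ 0ℤ
    2≈0 = begin
      + 2                                                   ≈⟨ +-cong det≈1 det≈1 ⟨
      d + d                                                 ≡⟨ twice-det (lift x₁) (lift y₁) (lift x₂) (lift y₂) ⟩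
      (lift x₁ + lift x₁) * lift y₂ - (lift x₂ + lift x₂) * lift y₁
                                                            ≈⟨ +-cong (*-cong 2x₁≈0 ≈-refl) (neg-cong (*-cong 2x₂≈0 ≈-refl)) ⟩
      0ℤ * lift y₂ - 0ℤ * lift y₁                           ≡⟨⟩
      0ℤ                                                    ∎
      where
      d : ℤ
      d = lift x₁ * lift y₂ - lift x₂ * lift y₁
      twice-det : ∀ x₁ y₁ x₂ y₂ →
                  (x₁ * y₂ - x₂ * y₁) + (x₁ * y₂ - x₂ * y₁) ≡ (x₁ + x₁) * y₂ - (x₂ + x₂) * y₁
      twice-det = solve 4 (λ x₁ y₁ x₂ y₂ →
        (x₁ :* y₂ :- x₂ :* y₁) :+ (x₁ :* y₂ :- x₂ :* y₁) := (x₁ :+ x₁) :* y₂ :- (x₂ :+ x₂) :* y₁) refl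

  allMatₙ : List Matₙ
  allMatₙ = cartesianProduct (cartesianProduct (allFin N) (allFin N)) (cartesianProduct (allFin N) (allFin N))

  -- SL₂, rises and adjacency are opaque: unfolding them during unification would make Agda
  -- evaluate arithmetic modulo N.
  opaque
    SL₂ : List Matₙ
    SL₂ = filter unimodular? allMatₙ

    SL₂-unique : Unique SL₂
    SL₂-unique = UniqueP.filter⁺ unimodular? (UniqueP.cartesianProduct⁺ allVecₙ-unique allVecₙ-unique)
      where
      allVecₙ-unique : Unique (cartesianProduct (allFin N) (allFin N))
      allVecₙ-unique = UniqueP.cartesianProduct⁺ (UniqueP.allFin⁺ N) (UniqueP.allFin⁺ N)

    ∈-SL₂ : ∀ {X} → Unimodular X → X ∈ SL₂
    ∈-SL₂ {(x₁ , y₁) , (x₂ , y₂)} det≈1 = ∈P.∈-filter⁺ unimodular?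
      (∈P.∈-cartesianProduct⁺ (∈P.∈-cartesianProduct⁺ (∈P.∈-allFin x₁) (∈P.∈-allFin y₁))
                              (∈P.∈-cartesianProduct⁺ (∈P.∈-allFin x₂) (∈P.∈-allFin y₂))) det≈1

    SL₂-unimodular : ∀ i → Unimodular (lookup SL₂ i)
    SL₂-unimodular i = proj₂ (∈P.∈-filter⁻ unimodular? {xs = allMatₙ} (∈P.∈-lookup i))

  SL₂-index : ∀ X → Unimodular X → Fin (length SL₂)
  SL₂-index X det≈1 = index (∈-SL₂ {X} det≈1)

  lookup-SL₂-index : ∀ X (det≈1 : Unimodular X) → lookup SL₂ (SL₂-index X det≈1) ≡ X
  lookup-SL₂-index X det≈1 = sym (lookup-index (∈-SL₂ {X} det≈1))

-- Sums, layers and closed walks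

lookup-injective : ∀ {A : Set} {xs : List A} → Unique xs → ∀ {i j} → lookup xs i ≡ lookup xs j → i ≡ j
lookup-injective (_  ∷ _) {Fin.zero}  {Fin.zero}  _  = refl
lookup-injective (x≢ ∷ _) {Fin.zero}  {Fin.suc j} eq = ⊥-elim (All.lookup x≢ (∈P.∈-lookup j) eq)
lookup-injective (x≢ ∷ _) {Fin.suc i} {Fin.zero}  eq = ⊥-elim (All.lookup x≢ (∈P.∈-lookup i) (sym eq))
lookup-injective (_  ∷ u) {Fin.suc i} {Fin.suc j} eq = cong Fin.suc (lookup-injective u eq)

δ : ∀ {k} → Fin k → Fin k → ℕ
δ Fin.zero    Fin.zero    = 1
δ Fin.zero    (Fin.suc _) = 0
δ (Fin.suc _) Fin.zero    = 0
δ (Fin.suc u) (Fin.suc w) = δ u w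

δ-refl : ∀ {k} (w : Fin k) → δ w w ≡ 1
δ-refl Fin.zero    = refl
δ-refl (Fin.suc w) = δ-refl w

δ-≢ : ∀ {k} {u w : Fin k} → u ≢ w → δ u w ≡ 0
δ-≢ {u = Fin.zero}  {Fin.zero}  u≢w = ⊥-elim (u≢w refl)
δ-≢ {u = Fin.zero}  {Fin.suc w} u≢w = refl
δ-≢ {u = Fin.suc u} {Fin.zero}  u≢w = refl
δ-≢ {u = Fin.suc u} {Fin.suc w} u≢w = δ-≢ (u≢w ∘ cong Fin.suc)

sum-tabulate-0 : ∀ k → sum (tabulate {n = k} (λ _ → 0)) ≡ 0
sum-tabulate-0 zero    = refl
sum-tabulate-0 (suc k) = sum-tabulate-0 k

sum-tabulate-δ : ∀ {k} (w : Fin k) → sum (tabulate (λ u → δ u w)) ≡ 1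
sum-tabulate-δ {suc k} Fin.zero    = cong suc (sum-tabulate-0 k)
sum-tabulate-δ {suc k} (Fin.suc w) = sum-tabulate-δ w

sum-tabulate-+ : ∀ {k} (f g : Fin k → ℕ) → sum (tabulate (λ u → f u ℕ.+ g u)) ≡ sum (tabulate f) ℕ.+ sum (tabulate g)
sum-tabulate-+ {zero}  f g = refl
sum-tabulate-+ {suc k} f g = begin
  f₀ ℕ.+ g₀ ℕ.+ sum (tabulate (λ u → f′ u ℕ.+ g′ u))     ≡⟨ cong (f₀ ℕ.+ g₀ ℕ.+_) (sum-tabulate-+ f′ g′) ⟩
  f₀ ℕ.+ g₀ ℕ.+ (sum (tabulate f′) ℕ.+ sum (tabulate g′))  ≡⟨ +-interchange f₀ g₀ _ _ ⟩
  f₀ ℕ.+ sum (tabulate f′) ℕ.+ (g₀ ℕ.+ sum (tabulate g′))  ∎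
  where
  open ≡-Reasoning
  f₀ g₀ : ℕ
  f₀ = f Fin.zero
  g₀ = g Fin.zero
  f′ g′ : Fin k → ℕ
  f′ = f ∘ Fin.suc
  g′ = g ∘ Fin.suc

sum-indicator-of-pair : ∀ {k} (I : Fin k → ℕ) {x y} → x ≢ y → I x ≡ 1 → I y ≡ 1 →
                        (∀ u → u ≢ x → u ≢ y → I u ≡ 0) → sum (map I (allFin k)) ≡ 2
sum-indicator-of-pair {k} I {x} {y} x≢y Ix≡1 Iy≡1 I≡0 = begin
  sum (map I (allFin k))                                          ≡⟨ cong sum (ListP.map-tabulate (λ u → u) I) ⟩
  sum (tabulate I)                                                ≡⟨ cong sum (ListP.tabulate-cong I≗δ+δ) ⟩
  sum (tabulate (λ u → δ u x ℕ.+ δ u y))                          ≡⟨ sum-tabulate-+ (λ u → δ u x) (λ u → δ u y) ⟩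
  sum (tabulate (λ u → δ u x)) ℕ.+ sum (tabulate (λ u → δ u y))  ≡⟨ cong₂ ℕ._+_ (sum-tabulate-δ x) (sum-tabulate-δ y) ⟩
  2                                                               ∎
  where
  open ≡-Reasoning
  I≗δ+δ : ∀ u → I u ≡ δ u x ℕ.+ δ u y
  I≗δ+δ u with u Fin.≟ x | u Fin.≟ y
  ... | yes refl | _        = trans Ix≡1 (sym (cong₂ ℕ._+_ (δ-refl x) (δ-≢ x≢y)))
  ... | no u≢x   | yes refl = trans Iy≡1 (sym (cong₂ ℕ._+_ (δ-≢ u≢x) (δ-refl y)))
  ... | no u≢x   | no u≢y   = trans (I≡0 u u≢x u≢y) (sym (cong₂ ℕ._+_ (δ-≢ u≢x) (δ-≢ u≢y)))

T-∨-inj₁ : ∀ {x y} → T x → T (x ∨ y)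
T-∨-inj₁ {x} {y} = Equivalence.from (BoolP.T-∨ {x} {y}) ∘ inj₁

T-∨-inj₂ : ∀ {x y} → T y → T (x ∨ y)
T-∨-inj₂ {x} {y} = Equivalence.from (BoolP.T-∨ {x} {y}) ∘ inj₂

T-∨-split : ∀ {x y} → T (x ∨ y) → T x ⊎ T y
T-∨-split {x} {y} = Equivalence.to (BoolP.T-∨ {x} {y})

¬T⇒≡false : ∀ {b} → ¬ T b → b ≡ false
¬T⇒≡false {b} = dec-false (T? b)

indicator-T : ∀ {b} → T b → (if b then 1 else 0) ≡ 1
indicator-T {b} tb = cong (if_then 1 else 0) (dec-true (T? b) tb)

indicator-¬T : ∀ {b} → ¬ T b → (if b then 1 else 0) ≡ 0
indicator-¬T ¬tb = cong (if_then 1 else 0) (¬T⇒≡false ¬tb)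

module Layers (t : ℕ) .{{_ : NonZero t}} where

  level : ∀ {k} → Fin k → ℕ
  level u = toℕ u ℕ./ t

  slot : ∀ {k} → Fin k → Fin t
  slot u = fromℕ< (m%n<n (toℕ u) t)

  toℕ≡slot+level*t : ∀ {k} (u : Fin k) → toℕ u ≡ toℕ (slot u) ℕ.+ level u ℕ.* t
  toℕ≡slot+level*t u =
    trans (m≡m%n+[m/n]*n (toℕ u) t) (cong (ℕ._+ level u ℕ.* t) (sym (FinP.toℕ-fromℕ< (m%n<n (toℕ u) t))))

  level-slot-injective : ∀ {k} {u v : Fin k} → level u ≡ level v → slot u ≡ slot v → u ≡ v
  level-slot-injective {u = u} {v} level≡ slot≡ = FinP.toℕ-injective (begin
    toℕ u                               ≡⟨ toℕ≡slot+level*t u ⟩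
    toℕ (slot u) ℕ.+ level u ℕ.* t      ≡⟨ cong₂ (λ i j → toℕ i ℕ.+ j ℕ.* t) slot≡ level≡ ⟩
    toℕ (slot v) ℕ.+ level v ℕ.* t      ≡⟨ toℕ≡slot+level*t v ⟨
    toℕ v                               ∎)
    where open ≡-Reasoning

  level*t≤toℕ : ∀ {k} (u : Fin k) → level u ℕ.* t ≤ toℕ u
  level*t≤toℕ u = subst (level u ℕ.* t ≤_) (sym (toℕ≡slot+level*t u)) (ℕP.m≤n+m _ _)

  toℕ<[1+level]*t : ∀ {k} (u : Fin k) → toℕ u < suc (level u) ℕ.* t
  toℕ<[1+level]*t u =
    subst (_< suc (level u) ℕ.* t) (sym (toℕ≡slot+level*t u)) (ℕP.+-monoˡ-< (level u ℕ.* t) (FinP.toℕ<n (slot u)))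

  level-fromℕ< : ∀ {k j} (i : Fin t) (lt : toℕ i ℕ.+ j ℕ.* t < k) → level (fromℕ< lt) ≡ j
  level-fromℕ< {j = j} i lt = begin
    toℕ (fromℕ< lt) ℕ./ t                       ≡⟨ cong (ℕ._/ t) (FinP.toℕ-fromℕ< lt) ⟩
    (toℕ i ℕ.+ j ℕ.* t) ℕ./ t                   ≡⟨ +-distrib-/-∣ʳ (toℕ i) (ℕD.n∣m*n j) ⟩
    toℕ i ℕ./ t ℕ.+ j ℕ.* t ℕ./ t               ≡⟨ cong₂ ℕ._+_ (m<n⇒m/n≡0 (FinP.toℕ<n i)) (m*n/n≡m j t) ⟩
    j                                           ∎
    where open ≡-Reasoning

  slot-fromℕ< : ∀ {k j} (i : Fin t) (lt : toℕ i ℕ.+ j ℕ.* t < k) → slot (fromℕ< lt) ≡ i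
  slot-fromℕ< {j = j} i lt = FinP.toℕ-injective (begin
    toℕ (slot (fromℕ< lt))           ≡⟨ FinP.toℕ-fromℕ< (m%n<n (toℕ (fromℕ< lt)) t) ⟩
    toℕ (fromℕ< lt) ℕ.% t            ≡⟨ cong (ℕ._% t) (FinP.toℕ-fromℕ< lt) ⟩
    (toℕ i ℕ.+ j ℕ.* t) ℕ.% t        ≡⟨ [m+kn]%n≡m%n (toℕ i) j t ⟩
    toℕ i ℕ.% t                      ≡⟨ m<n⇒m%n≡m (FinP.toℕ<n i) ⟩
    toℕ i                            ∎)
    where open ≡-Reasoning

record NonBacktrackingClosedWalk {n} (G : Graph n) (ℓ : ℕ) : Set where
  field
    walk            : ℕ → Fin n
    adjacent        : ∀ i → i < ℓ → T (adj G (walk i) (walk (suc i)))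
    closed          : walk ℓ ≡ walk 0
    nonBacktracking : ∀ i → suc i < ℓ → walk (suc (suc i)) ≢ walk i

cycle⇒nonBacktrackingClosedWalk : ∀ {n} {G : Graph n} {ℓ} → Cycle G ℓ → NonBacktrackingClosedWalk G ℓ
cycle⇒nonBacktrackingClosedWalk {G = G} {ℓ} C = record
  { walk = walk ; adjacent = adjacent ; closed = closed ; nonBacktracking = nonBacktracking }
  where
  open Cycle C
  0<ℓ : 0 < ℓ
  0<ℓ = ℕP.<-≤-trans (s≤s z≤n) len≥3
  instance
    ℓ-nonZero : NonZero ℓ
    ℓ-nonZero = ℕ.>-nonZero 0<ℓ
  position : ℕ → Fin ℓ
  position i = fromℕ< (m%n<n i ℓ)
  walk : ℕ → Fin _
  walk i = vertex (position i)
  toℕ-position : ∀ i → toℕ (position i) ≡ i ℕ.% ℓ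
  toℕ-position i = FinP.toℕ-fromℕ< (m%n<n i ℓ)
  toℕ-position-< : ∀ {i} → i < ℓ → toℕ (position i) ≡ i
  toℕ-position-< i<ℓ = trans (toℕ-position _) (m<n⇒m%n≡m i<ℓ)
  toℕ-position-ℓ : toℕ (position ℓ) ≡ 0
  toℕ-position-ℓ = trans (toℕ-position ℓ) (n%n≡0 ℓ)
  adjacent : ∀ i → i < ℓ → T (adj G (walk i) (walk (suc i)))
  adjacent i i<ℓ with suc i ℕP.<? ℓ
  ... | yes 1+i<ℓ = step (position i) (position (suc i))
                          (trans (cong suc (toℕ-position-< i<ℓ)) (sym (toℕ-position-< 1+i<ℓ)))
  ... | no  1+i≮ℓ = close (position i) (position (suc i)) (trans (cong suc (toℕ-position-< i<ℓ)) 1+i≡ℓ)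
                          (trans (cong (toℕ ∘ position) 1+i≡ℓ) toℕ-position-ℓ)
    where
    1+i≡ℓ : suc i ≡ ℓ
    1+i≡ℓ = ℕP.≤-antisym i<ℓ (ℕP.≮⇒≥ 1+i≮ℓ)
  closed : walk ℓ ≡ walk 0
  closed = cong vertex (FinP.toℕ-injective (trans toℕ-position-ℓ (sym (toℕ-position-< 0<ℓ))))
  nonBacktracking : ∀ i → suc i < ℓ → walk (suc (suc i)) ≢ walk i
  nonBacktracking i 1+i<ℓ walk≡ with suc (suc i) ℕP.<? ℓ
  ... | yes 2+i<ℓ = ℕP.m≢1+n+m i
                      (sym (trans (sym (toℕ-position-< 2+i<ℓ)) (trans (cong toℕ (inj walk≡)) (toℕ-position-< i<ℓ))))
    where
    i<ℓ : i < ℓ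
    i<ℓ = ℕP.<-trans (ℕP.n<1+n i) 1+i<ℓ
  ... | no  2+i≮ℓ = ℕP.<⇒≢ len≥3 (sym (trans (sym 2+i≡ℓ) (cong (λ j → suc (suc j)) i≡0)))
    where
    2+i≡ℓ : suc (suc i) ≡ ℓ
    2+i≡ℓ = ℕP.≤-antisym 1+i<ℓ (ℕP.≮⇒≥ 2+i≮ℓ)
    i≡0 : i ≡ 0
    i≡0 = trans (sym (toℕ-position-< (ℕP.<-trans (ℕP.n<1+n i) 1+i<ℓ)))
                (trans (cong toℕ (sym (inj walk≡))) (trans (cong (toℕ ∘ position) 2+i≡ℓ) toℕ-position-ℓ))

-- The layered graph

-- Vectors of norm at most 3 ^ (g + 1) + 3, such as a seed and its image under a word of length
-- at most g, are determined by their residues modulo N.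
modulus : ℕ → ℕ
modulus g = 4 ℕ.+ 3 ^ suc g

initialCount : ℕ → ℕ
initialCount g = length (Modulo.SL₂ (modulus g))

norm-seed : ∀ r → norm (seed r) ≡ 3
norm-seed A   = refl
norm-seed A⁻¹ = refl
norm-seed B   = refl
norm-seed B⁻¹ = refl

seed-orbit-small : ∀ {g} w m r → m ≤ g → norm (act⋆ w m (seed r)) ℕ.+ norm (seed r) < modulus g
seed-orbit-small {g} w m r m≤g = begin-strict
  norm (act⋆ w m (seed r)) ℕ.+ norm (seed r)  ≤⟨ ℕP.+-monoˡ-≤ _ (norm-act⋆ w m (seed r)) ⟩
  3 ^ m ℕ.* norm (seed r) ℕ.+ norm (seed r)   ≡⟨ cong (λ n → 3 ^ m ℕ.* n ℕ.+ n) (norm-seed r) ⟩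
  3 ^ m ℕ.* 3 ℕ.+ 3                           ≤⟨ ℕP.+-monoˡ-≤ 3 (ℕP.*-monoˡ-≤ 3 (ℕP.^-monoʳ-≤ 3 m≤g)) ⟩
  3 ^ g ℕ.* 3 ℕ.+ 3                           ≡⟨ cong (ℕ._+ 3) (ℕP.*-comm (3 ^ g) 3) ⟩
  3 ^ suc g ℕ.+ 3                             <⟨ ℕP.+-monoʳ-< (3 ^ suc g) (ℕP.n<1+n 3) ⟩
  3 ^ suc g ℕ.+ 4                             ≡⟨ ℕP.+-comm (3 ^ suc g) 4 ⟩
  modulus g                                   ∎
  where open ℕP.≤-Reasoning

LevelStep : Generator → ℕ → ℕ → Set
LevelStep A   i j = j ≡ suc i
LevelStep B   i j = j ≡ suc i
LevelStep A⁻¹ i j = i ≡ suc j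
LevelStep B⁻¹ i j = i ≡ suc j

LevelStep-backtrack : ∀ s {i j l} → LevelStep (inverse s) i j → LevelStep s j l → l ≡ i
LevelStep-backtrack A   i≡ l≡ = trans l≡ (sym i≡)
LevelStep-backtrack A⁻¹ j≡ j≡′ = ℕP.suc-injective (trans (sym j≡′) j≡)
LevelStep-backtrack B   i≡ l≡ = trans l≡ (sym i≡)
LevelStep-backtrack B⁻¹ j≡ j≡′ = ℕP.suc-injective (trans (sym j≡′) j≡)

LevelStep-adjacent : ∀ s {i j} → LevelStep s i j → j ≡ suc i ⊎ i ≡ suc j
LevelStep-adjacent A   = inj₁
LevelStep-adjacent B   = inj₁
LevelStep-adjacent A⁻¹ = inj₂
LevelStep-adjacent B⁻¹ = inj₂

isOdd : ℕ → Bool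
isOdd zero    = false
isOdd (suc n) = not (isOdd n)

module LayeredGraph (g k : ℕ) where

  open Modulo (modulus g)

  t : ℕ
  t = initialCount g

  identityₙ : Matₙ
  identityₙ = (Fin.suc Fin.zero , Fin.zero) , (Fin.zero , Fin.suc Fin.zero)

  identity-unimodular : Unimodular identityₙ
  identity-unimodular = ≈-refl

  instance
    t-nonZero : NonZero t
    t-nonZero = ℕ.>-nonZero (∈P.∈-length (∈-SL₂ {identityₙ} identity-unimodular))

  open Layers t

  label : Fin k → Matₙ
  label u = lookup SL₂ (slot u)

  level-label-injective : ∀ {u v} → level u ≡ level v → label u ≡ label v → u ≡ v
  level-label-injective level≡ label≡ = level-slot-injective level≡ (lookup-injective SL₂-unique label≡)

  opaque
    rises : Generator → Fin k → Fin k → Bool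
    rises s u v = ⌊ suc (level u) ℕP.≟ level v ⌋ ∧ ⌊ label v ≟ₘ mulₙ s (label u) ⌋

    rises-sound : ∀ s {u v} → T (rises s u v) → level v ≡ suc (level u) × label v ≡ mulₙ s (label u)
    rises-sound s {u} {v} r = let (l , m) = Equivalence.to (BoolP.T-∧ {⌊ suc (level u) ℕP.≟ level v ⌋}) r in
      sym (toWitness l) , toWitness m

    rises-complete : ∀ s {u v} → level v ≡ suc (level u) → label v ≡ mulₙ s (label u) → T (rises s u v)
    rises-complete s {u} {v} level≡ label≡ =
      Equivalence.from (BoolP.T-∧ {⌊ suc (level u) ℕP.≟ level v ⌋}) (fromWitness (sym level≡) , fromWitness label≡)

    rises-irrefl : ∀ s v → rises s v v ≡ false
    rises-irrefl s v =
      cong (_∧ ⌊ label v ≟ₘ mulₙ s (label v) ⌋) (trans (isYes≗does level?) (dec-false level? ℕP.1+n≢n))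
      where
      level? : Dec (suc (level v) ≡ level v)
      level? = suc (level v) ℕP.≟ level v

  edge : Generator → Fin k → Fin k → Bool
  edge A   u v = rises A u v
  edge B   u v = rises B u v
  edge A⁻¹ u v = rises A v u
  edge B⁻¹ u v = rises B v u

  edge-sound : ∀ s {u v} → T (edge s u v) → label v ≡ mulₙ s (label u) × LevelStep s (level u) (level v)
  edge-sound A   e = let (l , m) = rises-sound A e in m , l
  edge-sound B   e = let (l , m) = rises-sound B e in m , l
  edge-sound A⁻¹ e = let (l , m) = rises-sound A e in sym (trans (cong (mulₙ A⁻¹) m) (mulₙ-inverse A _)) , l
  edge-sound B⁻¹ e = let (l , m) = rises-sound B e in sym (trans (cong (mulₙ B⁻¹) m) (mulₙ-inverse B _)) , l

  edge-backtrack : ∀ s {u v w} → T (edge (inverse s) u v) → T (edge s v w) → w ≡ u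
  edge-backtrack s {u} {v} {w} e₁ e₂ = level-label-injective
    (LevelStep-backtrack s (proj₂ (edge-sound (inverse s) e₁)) (proj₂ (edge-sound s e₂)))
    (begin
      label w                                 ≡⟨ proj₁ (edge-sound s e₂) ⟩
      mulₙ s (label v)                        ≡⟨ cong (mulₙ s) (proj₁ (edge-sound (inverse s) e₁)) ⟩
      mulₙ s (mulₙ (inverse s) (label u))     ≡⟨ mulₙ-inverseʳ s (label u) ⟩
      label u                                 ∎)
    where open ≡-Reasoning

  ascends descends : Fin k → Fin k → Bool
  ascends  u v = edge A u v ∨ edge B u v
  descends u v = edge A⁻¹ u v ∨ edge B⁻¹ u v

  opaque
    adjacency : Fin k → Fin k → Bool
    adjacency u v = ascends u v ∨ descends u v

    adjacency-edge : ∀ {u v} → T (adjacency u v) → Σ Generator λ s → T (edge s u v)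
    adjacency-edge {u} {v} a with T-∨-split {ascends u v} a
    ... | inj₁ up   = [ (A ,_) , (B ,_) ]′ (T-∨-split {edge A u v} up)
    ... | inj₂ down = [ (A⁻¹ ,_) , (B⁻¹ ,_) ]′ (T-∨-split {edge A⁻¹ u v} down)

    edge⇒adjacency : ∀ s {u v} → T (edge s u v) → T (adjacency u v)
    edge⇒adjacency A   {u} {v} e = T-∨-inj₁ {ascends u v} (T-∨-inj₁ {edge A u v} e)
    edge⇒adjacency B   {u} {v} e = T-∨-inj₁ {ascends u v} (T-∨-inj₂ {edge A u v} e)
    edge⇒adjacency A⁻¹ {u} {v} e = T-∨-inj₂ {ascends u v} (T-∨-inj₁ {edge A⁻¹ u v} e)
    edge⇒adjacency B⁻¹ {u} {v} e = T-∨-inj₂ {ascends u v} (T-∨-inj₂ {edge A⁻¹ u v} e)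

    adjacency-sym : ∀ u v → adjacency u v ≡ adjacency v u
    adjacency-sym u v = BoolP.∨-comm (ascends u v) (descends u v)

    adjacency-irrefl : ∀ v → adjacency v v ≡ false
    adjacency-irrefl v rewrite rises-irrefl A v | rises-irrefl B v = refl

  graph : Graph k
  graph = record { adj = adjacency ; sym = adjacency-sym ; irrefl = adjacency-irrefl }

  adjacent-levels : ∀ {u v} → T (adjacency u v) → level v ≡ suc (level u) ⊎ level u ≡ suc (level v)
  adjacent-levels a = let (s , e) = adjacency-edge a in LevelStep-adjacent s (proj₂ (edge-sound s e))

  rises-later : ∀ s {u v} → T (rises s u v) → toℕ u < toℕ v
  rises-later s {u} {v} r = begin-strict
    toℕ u                <⟨ toℕ<[1+level]*t u ⟩
    suc (level u) ℕ.* t  ≡⟨ cong (ℕ._* t) (proj₁ (rises-sound s r)) ⟨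
    level v ℕ.* t        ≤⟨ level*t≤toℕ v ⟩
    toℕ v                ∎
    where open ℕP.≤-Reasoning

  initial-independent : ∀ u v → toℕ u < t → toℕ v < t → adjacency u v ≡ false
  initial-independent u v u<t v<t = ¬T⇒≡false λ a →
    [ (λ level-v≡ → ℕP.0≢1+n (trans (sym level-v) (trans level-v≡ (cong suc level-u))))
    , (λ level-u≡ → ℕP.0≢1+n (trans (sym level-u) (trans level-u≡ (cong suc level-v)))) ]′ (adjacent-levels a)
    where
    level-u : level u ≡ 0
    level-u = m<n⇒m/n≡0 u<t
    level-v : level v ≡ 0
    level-v = m<n⇒m/n≡0 v<t

  bipartite : Bipartite graph
  bipartite = (λ u → isOdd (level u)) , λ u v a →
    [ (λ level-v odd≡ → BoolP.not-¬ refl (trans odd≡ (cong isOdd level-v)))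
    , (λ level-u odd≡ → BoolP.not-¬ refl (trans (sym odd≡) (cong isOdd level-u))) ]′ (adjacent-levels a)

  module Below (v : Fin k) (0<level : 0 < level v) where

    j : ℕ
    j = ℕ.pred (level v)

    level≡1+j : level v ≡ suc j
    level≡1+j = sym (ℕP.suc-pred (level v) {{ℕ.>-nonZero 0<level}})

    lowered-unimodular : ∀ s → Unimodular (mulₙ (inverse s) (label v))
    lowered-unimodular s = mulₙ-unimodular (inverse s) (SL₂-unimodular (slot v))

    slotFor : Generator → Fin t
    slotFor s = SL₂-index (mulₙ (inverse s) (label v)) (lowered-unimodular s)

    slot+j*t<v : ∀ s → toℕ (slotFor s) ℕ.+ j ℕ.* t < toℕ v
    slot+j*t<v s = begin-strict
      toℕ (slotFor s) ℕ.+ j ℕ.* t  <⟨ ℕP.+-monoˡ-< (j ℕ.* t) (FinP.toℕ<n (slotFor s)) ⟩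
      suc j ℕ.* t                  ≡⟨ cong (ℕ._* t) level≡1+j ⟨
      level v ℕ.* t                ≤⟨ level*t≤toℕ v ⟩
      toℕ v                        ∎
      where open ℕP.≤-Reasoning

    slot+j*t<k : ∀ s → toℕ (slotFor s) ℕ.+ j ℕ.* t < k
    slot+j*t<k s = ℕP.<-trans (slot+j*t<v s) (FinP.toℕ<n v)

    below : Generator → Fin k
    below s = fromℕ< (slot+j*t<k s)

    level-below : ∀ s → level (below s) ≡ j
    level-below s = level-fromℕ< {j = j} (slotFor s) (slot+j*t<k s)

    label-below : ∀ s → label (below s) ≡ mulₙ (inverse s) (label v)
    label-below s = trans (cong (lookup SL₂) (slot-fromℕ< {j = j} (slotFor s) (slot+j*t<k s)))
                          (lookup-SL₂-index (mulₙ (inverse s) (label v)) (lowered-unimodular s))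

    below-earlier : ∀ s → toℕ (below s) < toℕ v
    below-earlier s = subst (_< toℕ v) (sym (FinP.toℕ-fromℕ< (slot+j*t<k s))) (slot+j*t<v s)

    below-rises : ∀ s → T (rises s (below s) v)
    below-rises s = rises-complete s (trans level≡1+j (cong suc (sym (level-below s))))
      (sym (trans (cong (mulₙ s) (label-below s)) (mulₙ-inverseʳ s (label v))))

    rises⇒below : ∀ s {u} → T (rises s u v) → u ≡ below s
    rises⇒below s r = let (level-v , label-v) = rises-sound s r in level-label-injective
      (trans (ℕP.suc-injective (trans (sym level-v) level≡1+j)) (sym (level-below s)))
      (trans (trans (sym (mulₙ-inverse s _)) (cong (mulₙ (inverse s)) (sym label-v))) (sym (label-below s)))

    below-A≢below-B : below A ≢ below B
    below-A≢below-B eq = mulₙ-A⁻¹≢mulₙ-B⁻¹ (s≤s (s≤s (s≤s z≤n))) {label v} (SL₂-unimodular (slot v))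
      (trans (sym (label-below A)) (trans (cong label eq) (label-below B)))

    earlier-edge⇒below : ∀ s {u} → T (edge s u v) → toℕ u < toℕ v → u ≡ below A ⊎ u ≡ below B
    earlier-edge⇒below A   e _   = inj₁ (rises⇒below A e)
    earlier-edge⇒below B   e _   = inj₂ (rises⇒below B e)
    earlier-edge⇒below A⁻¹ e u<v = ⊥-elim (ℕP.<-asym u<v (rises-later A e))
    earlier-edge⇒below B⁻¹ e u<v = ⊥-elim (ℕP.<-asym u<v (rises-later B e))

  earlierNeighbours≡2 : ∀ v → t ≤ toℕ v → earlierNeighbours graph Permutation.id v ≡ 2
  earlierNeighbours≡2 v t≤v =
    sum-indicator-of-pair I below-A≢below-B
      (below-counted A (below-rises A)) (below-counted B (below-rises B)) others-uncounted
    where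
    open Below v (m≥n⇒m/n>0 t≤v)
    I : Fin k → ℕ
    I u = if adjacency u v ∧ (toℕ u ℕ.<ᵇ toℕ v) then 1 else 0
    below-counted : ∀ s → T (edge s (below s) v) → I (below s) ≡ 1
    below-counted s e = indicator-T (Equivalence.from (BoolP.T-∧ {adjacency (below s) v})
      (edge⇒adjacency s e , ℕP.<⇒<ᵇ (below-earlier s)))
    others-uncounted : ∀ u → u ≢ below A → u ≢ below B → I u ≡ 0
    others-uncounted u u≢A u≢B = indicator-¬T λ i →
      let (a , u<v) = Equivalence.to (BoolP.T-∧ {adjacency u v}) i
          (s , e)   = adjacency-edge a
      in [ u≢A , u≢B ]′ (earlier-edge⇒below s e (ℕP.<ᵇ⇒< (toℕ u) (toℕ v) u<v))

  module WalkWord {m} (W : NonBacktrackingClosedWalk graph (suc m)) where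
    open NonBacktrackingClosedWalk W

    letter : ℕ → Generator
    letter i with i ℕP.<? suc m
    ... | yes i<ℓ = proj₁ (adjacency-edge (adjacent i i<ℓ))
    ... | no  _   = A

    letter-edge : ∀ i → i < suc m → T (edge (letter i) (walk i) (walk (suc i)))
    letter-edge i i<ℓ with i ℕP.<? suc m
    ... | yes i<ℓ′ = proj₂ (adjacency-edge (adjacent i i<ℓ′))
    ... | no  i≮ℓ  = ⊥-elim (i≮ℓ i<ℓ)

    letters-reduced : Reduced letter (suc m)
    letters-reduced i 1+i<ℓ letter≡ = nonBacktracking i 1+i<ℓ (edge-backtrack (letter (suc i))
      (subst (λ s → T (edge s (walk i) (walk (suc i)))) letter≡ (letter-edge i (ℕP.<-trans (ℕP.n<1+n i) 1+i<ℓ)))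
      (letter-edge (suc i) 1+i<ℓ))

    labels-follow-letters : ∀ i → i ≤ suc m → liftₘ (label (walk i)) ≈ₘ actₘ⋆ letter i (liftₘ (label (walk 0)))
    labels-follow-letters zero    _     = ≈ₘ-reflexive refl
    labels-follow-letters (suc i) 1+i≤ℓ = begin
      liftₘ (label (walk (suc i)))                  ≡⟨ cong liftₘ (proj₁ (edge-sound (letter i) (letter-edge i 1+i≤ℓ))) ⟩
      liftₘ (mulₙ (letter i) (label (walk i)))      ≈⟨ liftₘ-mulₙ (letter i) (label (walk i)) ⟩
      actₘ (letter i) (liftₘ (label (walk i)))      ≈⟨ actₘ-cong (letter i) (labels-follow-letters i (ℕP.<⇒≤ 1+i≤ℓ)) ⟩
      actₘ⋆ letter (suc i) (liftₘ (label (walk 0))) ∎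
      where open SetoidReasoning ≈ₘ-setoid

    word-fixes-label : actₘ⋆ letter (suc m) (liftₘ (label (walk 0))) ≈ₘ liftₘ (label (walk 0))
    word-fixes-label = ≈ₘ-sym (subst (λ u → liftₘ (label u) ≈ₘ actₘ⋆ letter (suc m) (liftₘ (label (walk 0))))
                                     closed (labels-follow-letters (suc m) ℕP.≤-refl))

    word-fixes-all : ∀ v → act⋆ letter (suc m) v ≈ᵥ v
    word-fixes-all = fixes-unimodular-basis⇒fixes-all
      (act⋆ letter (suc m)) (act⋆-+ᵥ letter (suc m)) (act⋆-· letter (suc m))
      (proj₁ word-fixes-label) (proj₂ word-fixes-label) (SL₂-unimodular (slot (walk 0)))

    walk-long : g < suc m
    walk-long = ℕP.≰⇒> λ ℓ≤g → no-reduced-word-fixes-seeds letter m letters-reduced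
      (λ r → ≈ᵥ-small⇒≡ (word-fixes-all (seed r)) (seed-orbit-small letter (suc m) r ℓ≤g))

  girth : GirthAtLeast graph g
  girth zero    C = ⊥-elim (ℕP.n≮0 (Cycle.len≥3 C))
  girth (suc m) C = ℕP.<⇒≤ (WalkWord.walk-long (cycle⇒nonBacktrackingClosedWalk C))

claim3p1 : ∀ (g : ℕ) → 1 ≤ g →
    Σ ℕ λ t → ∀ (k : ℕ) → t ≤ k →
      Σ (Graph k) λ G → ExactlyDegenerate 2 t G × Bipartite G × GirthAtLeast G g
claim3p1 g _ = initialCount g , λ k t≤k → let open LayeredGraph g k in
  graph , (Permutation.id , t≤k , initial-independent , earlierNeighbours≡2) , bipartite , girth
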